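{- Start with the wheel $C_6\vee K_1$ with rim cycle $(w_1,\dots,w_6,w_1)$ and hub $w_0$ adjacent to $w_1,\dots,w_6$. Join $w_1$ to $w_4$. Add a new vertex $v$ adjacent to $w_1,w_2,w_3,w_4$. Add a new vertex $z$ adjacent to $v,w_2,w_3$, and a new vertex $z'$ adjacent to $w_0,w_1,w_4$. Let $\overline{G}$ be the resulting graph and $G$ its complement. Then $\mathcal{I}(G)\cong\theta_{2,4,4}$.
   Context: For a graph $G$, an $i$-set is an independent dominating set of minimum cardinality. The $i$-graph $\mathcal{I}(G)$ has the $i$-sets as vertices, with $X\sim Y$ iff $Y=(X\setminus\{u\})\cup\{v\}$ for some $u\in X$, $v\notin X$ with $uv\in E(G)$. $\theta_{j,k,\ell}$ denotes two vertices joined by three internally vertex-disjoint paths of lengths $j,k,\ell$. -}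

module Defs where

open import Data.Nat using (ℕ; zero; suc; _+_; _∸_; _≤_)
open import Data.Fin using (Fin; toℕ)
open import Data.Fin.Subset using (Subset; _∈_; _∉_; ∣_∣; _∪_; _-_; ⁅_⁆)
open import Data.List using (List; []; _∷_; _++_; map; upTo)
open import Data.List.Membership.Propositional using () renaming (_∈_ to _∈ₗ_)
open import Data.Product using (Σ; ∃; _×_; _,_)
open import Data.Sum using (_⊎_)
open import Relation.Binary.PropositionalEquality using (_≡_; _≢_)
open import Relation.Nullary using (¬_)
open import Function.Definitions using (Injective)
open import Function.Bundles using (_⇔_)

record Graph (n : ℕ) : Set₁ where
  field
    Adj : Fin n → Fin n → Set
open Graph public

edgeGraph : (n : ℕ) → List (ℕ × ℕ) → Graph n
edgeGraph n es = record { Adj = λ x y → ((toℕ x , toℕ y) ∈ₗ es) ⊎ ((toℕ y , toℕ x) ∈ₗ es) }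

complement : ∀ {n} → Graph n → Graph n
complement G = record { Adj = λ x y → (x ≢ y) × ¬ Adj G x y }

module _ {n : ℕ} (G : Graph n) where
  Independent : Subset n → Set
  Independent S = ∀ x y → x ∈ S → y ∈ S → ¬ Adj G x y

  Dominating : Subset n → Set
  Dominating S = ∀ x → x ∈ S ⊎ (∃ λ y → y ∈ S × Adj G x y)

  IndepDom : Subset n → Set
  IndepDom S = Independent S × Dominating S

  IsISet : Subset n → Set
  IsISet S = IndepDom S × (∀ T → IndepDom T → ∣ S ∣ ≤ ∣ T ∣)

  IAdj : Subset n → Subset n → Set
  IAdj X Y = ∃ λ u → ∃ λ v → u ∈ X × v ∉ X × Adj G u v × Y ≡ ((X - u) ∪ ⁅ v ⁆)

IGraphIso : ∀ {m n} → Graph m → Graph n → Set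
IGraphIso {m} {n} H G =
  Σ (Fin m → Subset n) λ f →
    (∀ x → IsISet G (f x)) ×
    Injective _≡_ _≡_ f ×
    (∀ S → IsISet G S → ∃ λ x → f x ≡ S) ×
    (∀ x y → Adj H x y ⇔ IAdj G (f x) (f y))

consec : List ℕ → List (ℕ × ℕ)
consec [] = []
consec (a ∷ []) = []
consec (a ∷ b ∷ xs) = (a , b) ∷ consec (b ∷ xs)

-- path of length len from vertex 0 to vertex 1 whose (len ∸ 1) internal
-- vertices are s, s+1, ..., s + len ∸ 2
pathEdges : ℕ → ℕ → List (ℕ × ℕ)
pathEdges s len = consec (0 ∷ (map (s +_) (upTo (len ∸ 1)) ++ (1 ∷ [])))

thetaSize : ℕ → ℕ → ℕ → ℕ
thetaSize j k l = 2 + (j ∸ 1) + (k ∸ 1) + (l ∸ 1)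

-- θ_{j,k,l}: vertices 0 and 1 joined by three internally disjoint paths
-- of lengths j, k, l.
theta : (j k l : ℕ) → Graph (thetaSize j k l)
theta j k l = edgeGraph (thetaSize j k l)
  (pathEdges 2 j ++ pathEdges (2 + (j ∸ 1)) k ++ pathEdges (2 + (j ∸ 1) + (k ∸ 1)) l)

-- Vertex numbering: 0 = w0 (hub), 1..6 = w1..w6, 7 = v, 8 = z, 9 = z'.
Gbar : Graph 10
Gbar = edgeGraph 10
  ( (1 , 2) ∷ (2 , 3) ∷ (3 , 4) ∷ (4 , 5) ∷ (5 , 6) ∷ (6 , 1)
  ∷ (0 , 1) ∷ (0 , 2) ∷ (0 , 3) ∷ (0 , 4) ∷ (0 , 5) ∷ (0 , 6)
  ∷ (1 , 4)
  ∷ (7 , 1) ∷ (7 , 2) ∷ (7 , 3) ∷ (7 , 4)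
  ∷ (8 , 7) ∷ (8 , 2) ∷ (8 , 3)
  ∷ (9 , 0) ∷ (9 , 1) ∷ (9 , 4)
  ∷ [])

G : Graph 10
G = complement Gbar

-- Independent sets of G are cliques of Ḡ, and an independent dominating set
-- of G is a clique of Ḡ that no vertex outside it is completely joined to in Ḡ.
-- Ḡ has no such clique of size at most 2 and exactly nine such triangles: the
-- six hub triangles w₀wᵢwᵢ₊₁, and w₁w₂v, w₁w₄v, w₃w₄v (z blocks w₂w₃v, and
-- z′ blocks w₀w₁w₄).
-- So i(G) = 3, these nine triangles are the i-sets, and two of them are
-- adjacent in 𝓘(G) exactly when they share an edge of Ḡ, which yields θ₂,₄,₄.
module Submission where

open import Defs
open import Data.Nat using (ℕ; suc; _≤_; _≤?_)
open import Data.Nat.Properties using (≤-trans)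
import Data.Nat.Properties as ℕ
open import Data.Bool.Properties using () renaming (_≟_ to _≟ᵇ_)
open import Data.Fin using (Fin; zero; toℕ)
open import Data.Fin.Patterns
import Data.Fin.Properties as Fin
open import Data.Fin.Subset using (Subset; ∣_∣; _∪_; _-_; ⁅_⁆)
open import Data.Fin.Subset.Properties using (_∈?_; anySubset?)
open import Data.Vec.Properties using () renaming (≡-dec to ≡-decᵛ)
open import Data.List using (List)
import Data.List.Membership.DecPropositional as DecMembership
open import Data.Product using (∃; _×_; _,_; proj₁; proj₂)
open import Data.Product.Properties using () renaming (≡-dec to ≡-decˣ)
open import Relation.Binary.PropositionalEquality using (_≡_)
open import Relation.Nullary using (Dec)
open import Relation.Nullary.Decidable
  using (_×-dec_; _⊎-dec_; _→-dec_; ¬?; map′; toWitness; decidable-stable)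
open import Function using (_∘_)
open import Function.Definitions using (Injective)
open import Function.Bundles using (_⇔_; mk⇔; Equivalence)

_⇔-dec_ : ∀ {A B : Set} → Dec A → Dec B → Dec (A ⇔ B)
a? ⇔-dec b? = map′ (λ (to , from) → mk⇔ to from)
                   (λ e → Equivalence.to e , Equivalence.from e)
                   ((a? →-dec b?) ×-dec (b? →-dec a?))

allSubset? : ∀ {n} {P : Subset n → Set} → (∀ S → Dec (P S)) → Dec (∀ S → P S)
allSubset? P? = map′
  (λ ¬∃¬P S → decidable-stable (P? S) (λ ¬PS → ¬∃¬P (S , ¬PS)))
  (λ ∀P (S , ¬PS) → ¬PS (∀P S))
  (¬? (anySubset? (¬? ∘ P?)))

DecidableGraph : ∀ {n} → Graph n → Set
DecidableGraph {n} G = (x y : Fin n) → Dec (Adj G x y)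

edgeGraph-adj? : ∀ n (es : List (ℕ × ℕ)) → DecidableGraph (edgeGraph n es)
edgeGraph-adj? n es x y = ((toℕ x , toℕ y) ∈ₑ? es) ⊎-dec ((toℕ y , toℕ x) ∈ₑ? es)
  where open DecMembership (≡-decˣ ℕ._≟_ ℕ._≟_) using () renaming (_∈?_ to _∈ₑ?_)

complement-adj? : ∀ {n} {G : Graph n} → DecidableGraph G → DecidableGraph (complement G)
complement-adj? adj? x y = ¬? (x Fin.≟ y) ×-dec ¬? (adj? x y)

module _ {n} {G : Graph n} (adj? : DecidableGraph G) where

  independent? : ∀ S → Dec (Independent G S)
  independent? S = Fin.all? λ x → Fin.all? λ y →
    (x ∈? S) →-dec (y ∈? S) →-dec ¬? (adj? x y)

  dominating? : ∀ S → Dec (Dominating G S)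
  dominating? S = Fin.all? λ x → (x ∈? S) ⊎-dec Fin.any? λ y → (y ∈? S) ×-dec adj? x y

  indepDom? : ∀ S → Dec (IndepDom G S)
  indepDom? S = independent? S ×-dec dominating? S

  iAdj? : ∀ X Y → Dec (IAdj G X Y)
  iAdj? X Y = Fin.any? λ u → Fin.any? λ v →
    (u ∈? X) ×-dec ¬? (v ∈? X) ×-dec adj? u v ×-dec ≡-decᵛ _≟ᵇ_ Y ((X - u) ∪ ⁅ v ⁆)

IGraphIso-fromEnumeration :
  ∀ {m n} {H : Graph (suc m)} {G : Graph n} (k : ℕ) (f : Fin (suc m) → Subset n) →
  (∀ T → IndepDom G T → k ≤ ∣ T ∣) →
  (∀ x → IndepDom G (f x) × ∣ f x ∣ ≤ k) →
  Injective _≡_ _≡_ f →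
  (∀ S → IndepDom G S → ∣ S ∣ ≤ k → ∃ λ x → f x ≡ S) →
  (∀ x y → Adj H x y ⇔ IAdj G (f x) (f y)) →
  IGraphIso H G
IGraphIso-fromEnumeration {G = G} k f k≤ f-small f-inj f-onto f-adj =
  f , f-iSet , f-inj , onto , f-adj
  where
  f-iSet : ∀ x → IsISet G (f x)
  f-iSet x = proj₁ (f-small x) , λ T T-id → ≤-trans (proj₂ (f-small x)) (k≤ T T-id)

  onto : ∀ S → IsISet G S → ∃ λ x → f x ≡ S
  onto S (S-id , S-min) =
    f-onto S S-id (≤-trans (S-min (f zero) (proj₁ (f-small zero))) (proj₂ (f-small zero)))

pattern w₀ = 0F
pattern w₁ = 1F
pattern w₂ = 2F
pattern w₃ = 3F
pattern w₄ = 4F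
pattern w₅ = 5F
pattern w₆ = 6F
pattern v  = 7F

triangle : Fin 10 → Fin 10 → Fin 10 → Subset 10
triangle a b c = ⁅ a ⁆ ∪ ⁅ b ⁆ ∪ ⁅ c ⁆

-- In θ₂,₄,₄ as encoded in Defs, 0 and 1 are the branch vertices, 2 is the
-- middle of the 2-path, and 3,4,5 and 6,7,8 are the two 4-paths (from 0 to 1).
iSet : Fin 9 → Subset 10
iSet 0F = triangle w₀ w₁ w₂
iSet 1F = triangle w₀ w₃ w₄
iSet 2F = triangle w₀ w₂ w₃
iSet 3F = triangle w₀ w₁ w₆
iSet 4F = triangle w₀ w₅ w₆
iSet 5F = triangle w₀ w₄ w₅
iSet 6F = triangle w₁ w₂ v
iSet 7F = triangle w₁ w₄ v
iSet 8F = triangle w₃ w₄ v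

G-adj? : DecidableGraph G
G-adj? = complement-adj? (edgeGraph-adj? 10 _)

G-indepDomination≥3 : ∀ T → IndepDom G T → 3 ≤ ∣ T ∣
G-indepDomination≥3 =
  toWitness {a? = allSubset? λ T → indepDom? G-adj? T →-dec (3 ≤? ∣ T ∣)} _

iSet-indepDom : ∀ x → IndepDom G (iSet x) × ∣ iSet x ∣ ≤ 3
iSet-indepDom =
  toWitness {a? = Fin.all? λ x → indepDom? G-adj? (iSet x) ×-dec (∣ iSet x ∣ ≤? 3)} _

iSet-injective : Injective _≡_ _≡_ iSet
iSet-injective {x} {y} =
  toWitness {a? = Fin.all? λ x → Fin.all? λ y → ≡-decᵛ _≟ᵇ_ (iSet x) (iSet y) →-dec (x Fin.≟ y)} _ x y

iSet-complete : ∀ S → IndepDom G S → ∣ S ∣ ≤ 3 → ∃ λ x → iSet x ≡ S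
iSet-complete = toWitness {a? = allSubset? λ S →
  indepDom? G-adj? S →-dec (∣ S ∣ ≤? 3) →-dec Fin.any? λ x → ≡-decᵛ _≟ᵇ_ (iSet x) S} _

iSet-adj⇔ : ∀ x y → Adj (theta 2 4 4) x y ⇔ IAdj G (iSet x) (iSet y)
iSet-adj⇔ = toWitness {a? = Fin.all? λ x → Fin.all? λ y →
  edgeGraph-adj? 9 _ x y ⇔-dec iAdj? G-adj? (iSet x) (iSet y)} _

mainTheorem17 : IGraphIso (theta 2 4 4) G
mainTheorem17 = IGraphIso-fromEnumeration 3 iSet
  G-indepDomination≥3 iSet-indepDom iSet-injective iSet-complete iSet-adj⇔
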